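{- Let $\xi \in \mathbb{F}_q((T^{ -1})) \setminus \mathbb{F}_q(T)$ and let $\alpha \in \mathbb{F}_q((T^{ -1}))$ with $\alpha \notin \mathbb{F}_q[T] + \mathbb{F}_q[T]\,\xi$. Then there exist infinitely many nonzero polynomials $Q \in \mathbb{F}_q[T]$ such that \[ \| Q\xi - \alpha \| \leq \frac{1}{q^2 |Q|}. \] Moreover, the factor $q^2$ is best possible: there exists $\xi \in T^{ -1}\mathbb{F}_q[[T^{ -1}]] \setminus \mathbb{F}_q(T)$ such that \[ \| Q\xi - T^{ -1}(1-\xi) \| \geq \frac{1}{q^2 |Q|} \] for every $Q \in \mathbb{F}_q[T] \setminus \{0\}$.
   Context: $q$ is a prime power, $\mathbb{F}_q$ the field with $q$ elements, $\mathbb{F}_q[T]$ the polynomial ring and $\mathbb{F}_q(T)$ its fraction field. $\mathbb{F}_q((T^{ -1}))$ is the field of formal Laurent series $x=\sum_{i\ge -n} a_i T^{ -i}$ with $a_i\in\mathbb{F}_q$; for $x\neq 0$ with $a_{ -n}\ne 0$ the first nonzero coefficient, $\deg x = n$ and $|x| = q^{n}$; $|0|=0$. $T^{ -1}\mathbb{F}_q[[T^{ -1}]]$ is the set of $x$ with $|x|<1$. For $x \in \mathbb{F}_q((T^{ -1}))$, $[x]$ denotes the unique polynomial $P$ with $|x-P|<1$, and $\|x\| := |x - [x]|$ (the distance from $x$ to the nearest polynomial). -}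

module Defs where

open import Level using (0ℓ)
open import Data.Nat as ℕ using (ℕ; zero; suc)
open import Data.Integer as ℤ using (ℤ; +_; -[1+_])
open import Data.Fin using (Fin; fromℕ)
open import Data.List using (List; []; _∷_)
open import Data.Vec.Functional using (toList)
open import Data.Product using (Σ; ∃; _×_; _,_)
open import Relation.Binary.PropositionalEquality using (_≡_; _≢_)
open import Relation.Nullary using (¬_)
open import Algebra.Structures using (IsCommutativeRing)
open import Function.Bundles using (_↔_)

record FiniteField : Set₁ where
  infixl 6 _+_
  infixl 7 _*_
  field
    Carrier : Set
    _+_ _*_ : Carrier → Carrier → Carrier
    -_      : Carrier → Carrier
    0# 1#   : Carrier
    isCommutativeRing : IsCommutativeRing _≡_ _+_ _*_ -_ 0# 1#
    0≢1     : 0# ≢ 1#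
    inverse : ∀ x → x ≢ 0# → ∃ λ y → x * y ≡ 1#
    q       : ℕ
    enum    : Carrier ↔ Fin q

module LaurentSeries (F : FiniteField) where
  open FiniteField F

  -- A formal Laurent series  Σ c_i T^i  in 𝔽_q((T⁻¹)):
  -- coefficient function ℤ → 𝔽_q with only finitely many nonzero
  -- coefficients at positive powers of T.
  record Laurent : Set where
    constructor mkLaurent
    field
      coeff   : ℤ → Carrier
      bounded : ∃ λ (N : ℕ) → ∀ i → + N ℤ.< i → coeff i ≡ 0#
  open Laurent public

  -- Polynomials in 𝔽_q[T] as coefficient lists (constant term first).
  Poly : Set
  Poly = List Carrier

  record NZPoly : Set where
    constructor mkNZ
    field
      deg  : ℕ
      cf   : Fin (suc deg) → Carrier
      lead : cf (fromℕ deg) ≢ 0#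
  open NZPoly public

  coeffs : NZPoly → Poly
  coeffs Q = toList (cf Q)

  -- coefficient of T^i in the product P·x.
  -- (c + T·P') · x  has coefficient  c·x_i + (P'·x)_{i-1}  at T^i.
  mulC : Poly → (ℤ → Carrier) → ℤ → Carrier
  mulC []       x i = 0#
  mulC (c ∷ cs) x i = c * x i + mulC cs x (i ℤ.- ℤ.1ℤ)

  subC : (ℤ → Carrier) → (ℤ → Carrier) → ℤ → Carrier
  subC x y i = x i + (- y i)

  IsPolynomial : (ℤ → Carrier) → Set
  IsPolynomial x = ∀ i → i ℤ.< ℤ.0ℤ → x i ≡ 0#

  -- ξ ∈ 𝔽_q(T): ξ = A/P with P ≠ 0, i.e. P·ξ is a polynomial
  IsRational : Laurent → Set
  IsRational ξ = ∃ λ (P : NZPoly) → IsPolynomial (mulC (coeffs P) (coeff ξ))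

  -- α ∈ 𝔽_q[T] + 𝔽_q[T] ξ : α - Bξ is a polynomial for some B ∈ 𝔽_q[T]
  InLattice : Laurent → Laurent → Set
  InLattice ξ α = ∃ λ (B : Poly) → IsPolynomial (subC (coeff α) (mulC B (coeff ξ)))

  -- ‖x‖ ≤ q^{-k}: the coefficients of T^{-1}, …, T^{-(k-1)} all vanish
  -- (‖x‖ = q^{-m} with m the least i ≥ 1 such that x has nonzero T^{-i}-coefficient).
  NormLE : (ℤ → Carrier) → ℕ → Set
  NormLE x k = ∀ (i : ℕ) → 1 ℕ.≤ i → i ℕ.< k → x (ℤ.- (+ i)) ≡ 0#

  -- ‖x‖ ≥ q^{-k}: some coefficient of T^{-1}, …, T^{-k} is nonzero
  NormGE : (ℤ → Carrier) → ℕ → Set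
  NormGE x k = ∃ λ (i : ℕ) → 1 ℕ.≤ i × i ℕ.≤ k × x (ℤ.- (+ i)) ≢ 0#

  InTinvPowerSeries : Laurent → Set
  InTinvPowerSeries ξ = ∀ (i : ℕ) → coeff ξ (+ i) ≡ 0#

  -- coefficient function of T⁻¹(1 - ξ): coefficient at T^i is that of (1-ξ) at T^{i+1}
  oneC : ℤ → Carrier
  oneC (+ zero) = 1#
  oneC (+ suc n) = 0#
  oneC -[1+ n ] = 0#

  TinvOneMinus : Laurent → ℤ → Carrier
  TinvOneMinus ξ i = subC oneC (coeff ξ) (i ℤ.+ ℤ.1ℤ)

{-# OPTIONS --safe #-}

-- Write s k for the T^{-k} coefficient of ξ.  For Q of degree ≤ d, the coefficients of T^{-1}, …, T^{-(d+1)}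
-- in Qξ − α are given by the (d + 1) × (d + 1) Hankel system (s (i + j)) Q = (α coefficients).  When ξ is
-- irrational this matrix is invertible for arbitrarily large d: if Q is in its kernel for d₀ and Qξ has its
-- first nonzero fractional coefficient at T^{-(d+1)}, comparing Q′ {Qξ} with Q {Q′ξ} shows that every kernel
-- element Q′ for d has smaller degree than Q, so descending on the degree ends at an invertible size d.
-- Solving the system there gives Q with ‖Qξ − α‖ ≤ q^{-(d+2)} ≤ q^{-2} |Q|^{-1}; Q ≠ 0 because α ∉ 𝔽_q[T], and
-- a large d avoids finitely many given Q, because α ∉ 𝔽_q[T] + 𝔽_q[T] ξ.
--
-- For optimality let f = ∑ c k T^{-k} solve f = T^{-1} (f² − 1) and ξ = 1 + T f, so that
-- Qξ − T^{-1} (1 − ξ) ≡ (1 + T Q) f modulo 𝔽_q[T].  Every Hankel matrix (c (i + j)) is nonsingular: for a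
-- kernel vector r of size D + 1, the polynomial part of r f is a kernel vector of size D, as f² = T f + 1.
-- Taking r = 1 + T Q gives the lower bound, and r = T Q the irrationality of ξ.

module Submission where

open import Defs
open import Level using (0ℓ)
open import Axiom.ExcludedMiddle using (ExcludedMiddle)
open import Algebra.Bundles using (CommutativeRing)
open import Algebra.Core using (Op₁; Op₂)
open import Algebra.Structures using (IsCommutativeRing)
open import Data.Empty using (⊥-elim)
open import Data.Fin as Fin using (Fin; combine; remQuot; punchOut)
import Data.Fin.Properties as Finₚ
open import Data.Integer as ℤ using (ℤ; -[1+_]) renaming (+_ to pos)
open import Data.List using (List; []; _∷_)
open import Data.List.Relation.Unary.All as All using (All; []; _∷_)
open import Data.Nat as ℕ using (ℕ; zero; suc; _≤_; _<_; z≤n; s≤s; _∸_; _^_)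
import Data.Nat.Properties as ℕₚ
open import Data.Product using (∃; _×_; _,_; proj₁; proj₂)
open import Data.Sum as Sum using (_⊎_; inj₁; inj₂; [_,_]′)
open import Data.Vec.Functional using (toList)
open import Function.Base using (_∘_)
open import Function.Bundles using (Inverse; Injection; _↔_)
open import Function.Properties.Inverse using (↔⇒↣)
open import Function.Definitions using (Injective)
open import Relation.Binary.PropositionalEquality
open import Relation.Binary.Definitions using (tri<; tri≈; tri>)
open import Relation.Nullary using (¬_; Dec; yes; no; contradiction)
open import Relation.Nullary.Decidable using (via-injection)

infix 4 _≡[<_]_

_≡[<_]_ : {A : Set} → (ℕ → A) → ℕ → (ℕ → A) → Set
f ≡[< n ] g = ∀ j → j < n → f j ≡ g j

injective⇒onto : ∀ {n} (f : Fin n → Fin n) → Injective _≡_ _≡_ f → ∀ y → ∃ λ x → f x ≡ y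
injective⇒onto {zero}  f inj ()
injective⇒onto {suc n} f inj y with Finₚ.any? (λ x → f x Fin.≟ y)
... | yes hit = hit
... | no miss = contradiction (Finₚ.injective⇒≤ squeeze-injective) ℕₚ.1+n≰n
  where
  squeeze : Fin (suc n) → Fin n
  squeeze x = punchOut {i = y} {j = f x} (λ y≡fx → miss (x , sym y≡fx))

  squeeze-injective : Injective _≡_ _≡_ squeeze
  squeeze-injective {x} {x′} eq = inj (Finₚ.punchOut-injective {i = y} {f x} {f x′} _ _ eq)

module PrefixCode {A : Set} {q : ℕ} (enum : A ↔ Fin q) (a₀ : A) where
  open Inverse enum using (to; from; strictlyInverseˡ)

  encode : ∀ n → (ℕ → A) → Fin (q ^ n)
  encode zero    f = Fin.zero
  encode (suc n) f = combine (to (f 0)) (encode n (f ∘ suc))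

  decode : ∀ n → Fin (q ^ n) → ℕ → A
  decode zero    x j       = a₀
  decode (suc n) x zero    = from (proj₁ (remQuot {q} (q ^ n) x))
  decode (suc n) x (suc j) = decode n (proj₂ (remQuot {q} (q ^ n) x)) j

  encode-decode : ∀ n x → encode n (decode n x) ≡ x
  encode-decode zero    Fin.zero = refl
  encode-decode (suc n) x =
    trans (cong₂ combine (strictlyInverseˡ _) (encode-decode n _)) (Finₚ.combine-remQuot {q} (q ^ n) x)

  encode-cong : ∀ n {f g} → f ≡[< n ] g → encode n f ≡ encode n g
  encode-cong zero    f≡g = refl
  encode-cong (suc n) f≡g =
    cong₂ combine (cong to (f≡g 0 (s≤s z≤n))) (encode-cong n (λ j j<n → f≡g (suc j) (s≤s j<n)))

  encode-injective : ∀ n {f g} → encode n f ≡ encode n g → f ≡[< n ] g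
  encode-injective (suc n) {f} {g} eq zero _ =
    Injection.injective (↔⇒↣ enum) (Finₚ.combine-injectiveˡ (to (f 0)) _ (to (g 0)) _ eq)
  encode-injective (suc n) {f} {g} eq (suc j) (s≤s j<n) =
    encode-injective n (Finₚ.combine-injectiveʳ (to (f 0)) _ (to (g 0)) _ eq) j j<n

  prefixInjective⇒onto : ∀ n (φ : (ℕ → A) → ℕ → A) →
    (∀ {f g} → f ≡[< n ] g → φ f ≡[< n ] φ g) →
    (∀ {f g} → φ f ≡[< n ] φ g → f ≡[< n ] g) →
    ∀ t → ∃ λ u → φ u ≡[< n ] t
  prefixInjective⇒onto n φ φ-cong φ-injective t =
    let x , φx≡t = injective⇒onto φ̂ φ̂-injective (encode n t)
    in decode n x , encode-injective n φx≡t
    where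
    φ̂ : Fin (q ^ n) → Fin (q ^ n)
    φ̂ x = encode n (φ (decode n x))

    φ̂-injective : Injective _≡_ _≡_ φ̂
    φ̂-injective {x} {y} eq = begin
      x                        ≡⟨ encode-decode n x ⟨
      encode n (decode n x)    ≡⟨ encode-cong n (φ-injective (encode-injective n eq)) ⟩
      encode n (decode n y)    ≡⟨ encode-decode n y ⟩
      y                        ∎
      where open ≡-Reasoning

module PrefixSum {A : Set} {add mul : Op₂ A} {neg : Op₁ A} {zero# one# : A}
                 (isCommutativeRing : IsCommutativeRing _≡_ add mul neg zero# one#) where
  private
    R : CommutativeRing 0ℓ 0ℓ
    R = record { isCommutativeRing = isCommutativeRing }
  open CommutativeRing R
    using (_+_; _*_; -_; 0#; +-assoc; +-comm; +-identityˡ; +-identityʳ; *-comm; distribˡ; zeroʳ;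
           ring; +-commutativeSemigroup)
  open import Algebra.Properties.Ring ring using (-0#≈0#; -‿anti-homo-+)
  open import Algebra.Properties.CommutativeSemigroup +-commutativeSemigroup
    using () renaming (interchange to +-interchange)
  open ≡-Reasoning

  ∑ : ℕ → (ℕ → A) → A
  ∑ zero    f = 0#
  ∑ (suc n) f = f 0 + ∑ n (f ∘ suc)

  ∑-cong : ∀ n {f g} → f ≡[< n ] g → ∑ n f ≡ ∑ n g
  ∑-cong zero    f≡g = refl
  ∑-cong (suc n) f≡g = cong₂ _+_ (f≡g 0 (s≤s z≤n)) (∑-cong n (λ j j<n → f≡g (suc j) (s≤s j<n)))

  ∑-zero : ∀ n {f} → (∀ j → j < n → f j ≡ 0#) → ∑ n f ≡ 0#
  ∑-zero zero    f≡0 = refl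
  ∑-zero (suc n) f≡0 = begin
    _ + ∑ n _  ≡⟨ cong₂ _+_ (f≡0 0 (s≤s z≤n)) (∑-zero n (λ j j<n → f≡0 (suc j) (s≤s j<n))) ⟩
    0# + 0#    ≡⟨ +-identityˡ 0# ⟩
    0#         ∎

  ∑-distrib-+ : ∀ n (f g : ℕ → A) → ∑ n (λ i → f i + g i) ≡ ∑ n f + ∑ n g
  ∑-distrib-+ zero    f g = sym (+-identityˡ 0#)
  ∑-distrib-+ (suc n) f g =
    trans (cong (f 0 + g 0 +_) (∑-distrib-+ n (f ∘ suc) (g ∘ suc))) (+-interchange (f 0) (g 0) _ _)

  *-distribˡ-∑ : ∀ n a (f : ℕ → A) → a * ∑ n f ≡ ∑ n (λ i → a * f i)
  *-distribˡ-∑ zero    a f = zeroʳ a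
  *-distribˡ-∑ (suc n) a f = trans (distribˡ a (f 0) _) (cong (a * f 0 +_) (*-distribˡ-∑ n a (f ∘ suc)))

  *-distribʳ-∑ : ∀ n a (f : ℕ → A) → ∑ n f * a ≡ ∑ n (λ i → f i * a)
  *-distribʳ-∑ n a f = trans (*-comm _ a) (trans (*-distribˡ-∑ n a f) (∑-cong n (λ i _ → *-comm a (f i))))

  -‿distrib-∑ : ∀ n (f : ℕ → A) → - ∑ n f ≡ ∑ n (λ i → - f i)
  -‿distrib-∑ zero    f = -0#≈0#
  -‿distrib-∑ (suc n) f =
    trans (-‿anti-homo-+ (f 0) _) (trans (+-comm _ _) (cong (- f 0 +_) (-‿distrib-∑ n (f ∘ suc))))

  ∑-comm : ∀ m n (f : ℕ → ℕ → A) → ∑ m (λ i → ∑ n (f i)) ≡ ∑ n (λ j → ∑ m (λ i → f i j))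
  ∑-comm zero    n f = sym (∑-zero n (λ _ _ → refl))
  ∑-comm (suc m) n f = trans (cong (∑ n (f 0) +_) (∑-comm m n (f ∘ suc)))
                             (sym (∑-distrib-+ n (f 0) (λ j → ∑ m (λ i → f (suc i) j))))

  ∑-split : ∀ k l (f : ℕ → A) → ∑ (k ℕ.+ l) f ≡ ∑ k f + ∑ l (λ m → f (k ℕ.+ m))
  ∑-split zero    l f = sym (+-identityˡ _)
  ∑-split (suc k) l f = trans (cong (f 0 +_) (∑-split k l (f ∘ suc))) (sym (+-assoc _ _ _))

  ∑-truncate : ∀ {j n} (f : ℕ → A) → j ≤ n → (∀ m → j ≤ m → m < n → f m ≡ 0#) → ∑ n f ≡ ∑ j f
  ∑-truncate {j} {n} f j≤n f≡0 = begin
    ∑ n f                                    ≡⟨ cong (λ t → ∑ t f) (ℕₚ.m+[n∸m]≡n j≤n) ⟨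
    ∑ (j ℕ.+ (n ∸ j)) f                      ≡⟨ ∑-split j (n ∸ j) f ⟩
    ∑ j f + ∑ (n ∸ j) (λ m → f (j ℕ.+ m))    ≡⟨ cong (∑ j f +_) (∑-zero (n ∸ j) tail≡0) ⟩
    ∑ j f + 0#                               ≡⟨ +-identityʳ _ ⟩
    ∑ j f                                    ∎
    where
    tail≡0 : ∀ m → m < n ∸ j → f (j ℕ.+ m) ≡ 0#
    tail≡0 m m<n∸j = f≡0 (j ℕ.+ m) (ℕₚ.m≤m+n j m)
      (subst (j ℕ.+ m <_) (ℕₚ.m+[n∸m]≡n j≤n) (ℕₚ.+-monoʳ-< j m<n∸j))

  ∑-single : ∀ n (f : ℕ → A) i → i < n → (∀ j → j < n → j ≢ i → f j ≡ 0#) → ∑ n f ≡ f i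
  ∑-single (suc n) f zero _ f≡0 =
    trans (cong (f 0 +_) (∑-zero n (λ j j<n → f≡0 (suc j) (s≤s j<n) (λ ())))) (+-identityʳ _)
  ∑-single (suc n) f (suc i) (s≤s i<n) f≡0 =
    trans (cong₂ _+_ (f≡0 0 (s≤s z≤n) (λ ()))
                     (∑-single n (f ∘ suc) i i<n λ j j<n j≢i →
                       f≡0 (suc j) (s≤s j<n) (j≢i ∘ ℕₚ.suc-injective)))
          (+-identityˡ _)

module Field (F : FiniteField) where
  open FiniteField F public
  open PrefixSum isCommutativeRing public

  ring : CommutativeRing 0ℓ 0ℓ
  ring = record { isCommutativeRing = isCommutativeRing }
  open CommutativeRing ring public
    using (+-comm; +-identityˡ; +-identityʳ; *-assoc; *-comm; *-identityˡ; distribˡ; distribʳ; zeroˡ; zeroʳ)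
  open import Algebra.Properties.Ring (CommutativeRing.ring ring) public
    using (-‿distribˡ-*; -‿involutive; -0#≈0#; x∙y⁻¹≈ε⇒x≈y; x≈y⇒x∙y⁻¹≈ε)
  open import Algebra.Properties.CommutativeSemigroup (CommutativeRing.*-commutativeSemigroup ring) public
    using () renaming (x∙yz≈y∙xz to x*yz≡y*xz)
  open ≡-Reasoning

  infix 4 _≟_
  _≟_ : (x y : Carrier) → Dec (x ≡ y)
  _≟_ = via-injection (↔⇒↣ enum) Fin._≟_

  x*y≡0⇒y≡0 : ∀ {x y} → x ≢ 0# → x * y ≡ 0# → y ≡ 0#
  x*y≡0⇒y≡0 {x} {y} x≢0 xy≡0 = let x⁻¹ , xx⁻¹≡1 = inverse x x≢0 in begin
    y               ≡⟨ *-identityˡ y ⟨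
    1# * y          ≡⟨ cong (_* y) (trans (sym xx⁻¹≡1) (*-comm x x⁻¹)) ⟩
    (x⁻¹ * x) * y   ≡⟨ *-assoc x⁻¹ x y ⟩
    x⁻¹ * (x * y)   ≡⟨ cong (x⁻¹ *_) xy≡0 ⟩
    x⁻¹ * 0#        ≡⟨ zeroʳ x⁻¹ ⟩
    0#              ∎

  *-nonzero : ∀ {x y} → x ≢ 0# → y ≢ 0# → x * y ≢ 0#
  *-nonzero x≢0 y≢0 xy≡0 = y≢0 (x*y≡0⇒y≡0 x≢0 xy≡0)

  -1#≢0# : - 1# ≢ 0#
  -1#≢0# -1≡0 = 0≢1 (sym (trans (sym (-‿involutive 1#)) (trans (cong -_ -1≡0) -0#≈0#)))

  x-y≢0⇒y-x≢0 : ∀ {x y} → x + - y ≢ 0# → y + - x ≢ 0#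
  x-y≢0⇒y-x≢0 {x} {y} x-y≢0 y-x≡0 = x-y≢0 (x≈y⇒x∙y⁻¹≈ε (sym (x∙y⁻¹≈ε⇒x≈y y x y-x≡0)))

module Sequences (F : FiniteField) where
  open Field F
  open LaurentSeries F
  open ≡-Reasoning

  coeffAt : ∀ {n} → (Fin n → Carrier) → ℕ → Carrier
  coeffAt {zero}  v j       = 0#
  coeffAt {suc n} v zero    = v Fin.zero
  coeffAt {suc n} v (suc j) = coeffAt (v ∘ Fin.suc) j

  coeffAt-toℕ : ∀ {n} (v : Fin n → Carrier) i → coeffAt v (Fin.toℕ i) ≡ v i
  coeffAt-toℕ v Fin.zero    = refl
  coeffAt-toℕ v (Fin.suc i) = coeffAt-toℕ (v ∘ Fin.suc) i

  coeffAt-tabulate : ∀ {n} (u : ℕ → Carrier) → coeffAt {n} (u ∘ Fin.toℕ) ≡[< n ] u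
  coeffAt-tabulate {suc n} u zero    _         = refl
  coeffAt-tabulate {suc n} u (suc j) (s≤s j<n) = coeffAt-tabulate {n} (u ∘ suc) j j<n

  coeffAt-lead : ∀ Q → coeffAt (cf Q) (deg Q) ≢ 0#
  coeffAt-lead Q lead≡0 = lead Q (begin
    cf Q (Fin.fromℕ (deg Q))                     ≡⟨ coeffAt-toℕ (cf Q) (Fin.fromℕ (deg Q)) ⟨
    coeffAt (cf Q) (Fin.toℕ (Fin.fromℕ (deg Q))) ≡⟨ cong (coeffAt (cf Q)) (Finₚ.toℕ-fromℕ (deg Q)) ⟩
    coeffAt (cf Q) (deg Q)                       ≡⟨ lead≡0 ⟩
    0#                                           ∎)

  toNZPoly : (u : ℕ → Carrier) (e : ℕ) → u e ≢ 0# → NZPoly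
  toNZPoly u e u≢0 = mkNZ e (u ∘ Fin.toℕ) (u≢0 ∘ trans (cong u (sym (Finₚ.toℕ-fromℕ e))))

  neg : ℕ → ℤ
  neg k = ℤ.- pos k

  neg-suc : ∀ k → neg k ℤ.- ℤ.1ℤ ≡ neg (suc k)
  neg-suc zero    = refl
  neg-suc (suc k) = cong (λ t → -[1+ suc t ]) (ℕₚ.+-identityʳ k)

  -- With s k the T^{-k} coefficient of ξ, hankel s n p k is the T^{-k} coefficient of (∑_{j<n} p j T^j) ξ.
  hankel : (ℕ → Carrier) → ℕ → (ℕ → Carrier) → ℕ → Carrier
  hankel s n p k = ∑ n (λ j → p j * s (k ℕ.+ j))

  hankel-cong : ∀ s n {p p′} → p ≡[< n ] p′ → ∀ k → hankel s n p k ≡ hankel s n p′ k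
  hankel-cong s n p≡p′ k = ∑-cong n (λ j j<n → cong (_* s (k ℕ.+ j)) (p≡p′ j j<n))

  hankel-truncate : ∀ s {e n} p → e ≤ n → (∀ j → e ≤ j → j < n → p j ≡ 0#) →
                    ∀ k → hankel s n p k ≡ hankel s e p k
  hankel-truncate s p e≤n p≡0 k =
    ∑-truncate _ e≤n (λ j e≤j j<n → trans (cong (_* s (k ℕ.+ j)) (p≡0 j e≤j j<n)) (zeroˡ _))

  hankel-sub : ∀ s n f g k → hankel s n (λ j → f j + - g j) k ≡ hankel s n f k + - hankel s n g k
  hankel-sub s n f g k = begin
    ∑ n (λ j → (f j + - g j) * s (k ℕ.+ j))
      ≡⟨ ∑-cong n (λ j _ → trans (distribʳ _ _ _) (cong (f j * s (k ℕ.+ j) +_) (sym (-‿distribˡ-* _ _)))) ⟩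
    ∑ n (λ j → f j * s (k ℕ.+ j) + - (g j * s (k ℕ.+ j)))
      ≡⟨ ∑-distrib-+ n _ _ ⟩
    hankel s n f k + ∑ n (λ j → - (g j * s (k ℕ.+ j)))
      ≡⟨ cong (hankel s n f k +_) (-‿distrib-∑ n _) ⟨
    hankel s n f k + - hankel s n g k
      ∎

  mulC-neg : ∀ {n} (v : Fin n → Carrier) x k →
             mulC (toList v) x (neg k) ≡ hankel (x ∘ neg) n (coeffAt v) k
  mulC-neg {zero}  v x k = refl
  mulC-neg {suc n} v x k = cong₂ _+_
    (cong (λ t → v Fin.zero * x (neg t)) (sym (ℕₚ.+-identityʳ k)))
    (begin
      mulC (toList (v ∘ Fin.suc)) x (neg k ℤ.- ℤ.1ℤ)
        ≡⟨ cong (mulC (toList (v ∘ Fin.suc)) x) (neg-suc k) ⟩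
      mulC (toList (v ∘ Fin.suc)) x (neg (suc k))
        ≡⟨ mulC-neg (v ∘ Fin.suc) x (suc k) ⟩
      hankel (x ∘ neg) n (coeffAt (v ∘ Fin.suc)) (suc k)
        ≡⟨ ∑-cong n (λ j _ → cong (λ t → coeffAt (v ∘ Fin.suc) j * x (neg t)) (sym (ℕₚ.+-suc k j))) ⟩
      ∑ n (λ j → coeffAt (v ∘ Fin.suc) j * x (neg (k ℕ.+ suc j)))
        ∎)

  hankel-toNZPoly : ∀ s (u : ℕ → Carrier) e u≢0 {n} → e < n → (∀ j → e < j → j < n → u j ≡ 0#) →
                    ∀ k → hankel s (suc e) (coeffAt (cf (toNZPoly u e u≢0))) k ≡ hankel s n u k
  hankel-toNZPoly s u e u≢0 {n} e<n u≡0 k = begin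
    hankel s (suc e) (coeffAt {suc e} (u ∘ Fin.toℕ)) k  ≡⟨ hankel-cong s (suc e) (coeffAt-tabulate u) k ⟩
    hankel s (suc e) u k                               ≡⟨ hankel-truncate s {suc e} {n} u e<n u≡0 k ⟨
    hankel s n u k                                     ∎

  -- FirstNonzero (x ∘ neg) m says ‖x‖ = q^{-m}.
  FirstNonzero : (ℕ → Carrier) → ℕ → Set
  FirstNonzero f m = 1 ≤ m × (∀ k → 1 ≤ k → k < m → f k ≡ 0#) × f m ≢ 0#

  firstNonzero-unique : ∀ {f m m′} → FirstNonzero f m → FirstNonzero f m′ → m ≡ m′
  firstNonzero-unique {m = m} {m′} (1≤m , below , fm≢0) (1≤m′ , below′ , fm′≢0) with ℕₚ.<-cmp m m′
  ... | tri< m<m′ _ _ = contradiction (below′ m 1≤m m<m′) fm≢0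
  ... | tri≈ _ m≡m′ _ = m≡m′
  ... | tri> _ _ m>m′ = contradiction (below m′ 1≤m′ m>m′) fm′≢0

  firstNonzero-cong : ∀ {f g m} → (∀ k → f k ≡ g k) → FirstNonzero f m → FirstNonzero g m
  firstNonzero-cong f≡g (1≤m , below , fm≢0) =
    1≤m , (λ k 1≤k k<m → trans (sym (f≡g k)) (below k 1≤k k<m)) , fm≢0 ∘ trans (f≡g _)

  firstNonzero-or-vanish : ∀ K f → (∃ λ m → m ≤ K × FirstNonzero f m) ⊎ (∀ k → 1 ≤ k → k ≤ K → f k ≡ 0#)
  firstNonzero-or-vanish zero    f = inj₂ λ { (suc k) _ () }
  firstNonzero-or-vanish (suc K) f with firstNonzero-or-vanish K f
  ... | inj₁ (m , m≤K , first) = inj₁ (m , ℕₚ.m≤n⇒m≤1+n m≤K , first)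
  ... | inj₂ upto-K with f (suc K) ≟ 0#
  ...   | no fK≢0 = inj₁ (suc K , ℕₚ.≤-refl , s≤s z≤n , (λ k 1≤k k<1+K → upto-K k 1≤k (ℕₚ.≤-pred k<1+K)) , fK≢0)
  ...   | yes fK≡0 = inj₂ λ k 1≤k k≤1+K →
    [ (λ k<1+K → upto-K k 1≤k (ℕₚ.≤-pred k<1+K)) , (λ { refl → fK≡0 }) ]′ (ℕₚ.m≤n⇒m<n∨m≡n k≤1+K)

  lastNonzero-or-vanish : ∀ n (u : ℕ → Carrier) →
    (∃ λ e → e < n × u e ≢ 0# × (∀ j → e < j → j < n → u j ≡ 0#)) ⊎ (∀ j → j < n → u j ≡ 0#)
  lastNonzero-or-vanish zero    u = inj₂ λ _ ()
  lastNonzero-or-vanish (suc n) u with u n ≟ 0#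
  ... | no un≢0 = inj₁ (n , ℕₚ.≤-refl , un≢0 , λ j n<j j<1+n → contradiction (ℕₚ.≤-pred j<1+n) (ℕₚ.<⇒≱ n<j))
  ... | yes un≡0 = Sum.map
    (λ (e , e<n , ue≢0 , above) → e , ℕₚ.m≤n⇒m≤1+n e<n , ue≢0 , λ j e<j → extend j (above j e<j))
    (λ below j → extend j (below j))
    (lastNonzero-or-vanish n u)
    where
    extend : ∀ j → (j < n → u j ≡ 0#) → j < suc n → u j ≡ 0#
    extend j below j<1+n = [ below , (λ { refl → un≡0 }) ]′ (ℕₚ.m<1+n⇒m<n∨m≡n j<1+n)

  nonpolynomial⇒firstNonzero : ExcludedMiddle 0ℓ → ∀ f → ¬ IsPolynomial f → ∃ (FirstNonzero (f ∘ neg))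
  nonpolynomial⇒firstNonzero em f ¬poly with em {∃ λ k → 1 ≤ k × f (neg k) ≢ 0#}
  ... | no none = contradiction polynomial ¬poly
    where
    polynomial : IsPolynomial f
    polynomial (pos _) (ℤ.+<+ ())
    polynomial -[1+ k ] _ with f -[1+ k ] ≟ 0#
    ... | yes fk≡0 = fk≡0
    ... | no fk≢0 = contradiction (suc k , s≤s z≤n , fk≢0) none
  ... | yes (k , 1≤k , fk≢0) with firstNonzero-or-vanish k (f ∘ neg)
  ...   | inj₁ (m , _ , first) = m , first
  ...   | inj₂ upto-k = contradiction (upto-k k 1≤k ℕₚ.≤-refl) fk≢0

module HankelCross (F : FiniteField) (s : ℕ → FiniteField.Carrier F) where
  open Field F
  open Sequences F
  open import Algebra.Properties.CommutativeSemigroup ℕₚ.+-commutativeSemigroup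
    using () renaming (xy∙z≈xz∙y to +-right-comm)

  -- For polynomials P, P′ with coefficients p, p′ and degrees e, e′, and s the coefficients of ξ,
  -- cross e p e′ p′ n is the T^{-n} coefficient of P′ {Pξ}, where {·} is the fractional part.
  -- It is symmetric because P′ {Pξ} − P {P′ξ} = P [P′ξ] − P′ [Pξ] is a polynomial.
  cross : ℕ → (ℕ → Carrier) → ℕ → (ℕ → Carrier) → ℕ → Carrier
  cross e p e′ p′ n = ∑ (suc e′) (λ i → p′ i * hankel s (suc e) p (n ℕ.+ i))

  cross-sym : ∀ e p e′ p′ n → cross e p e′ p′ n ≡ cross e′ p′ e p n
  cross-sym e p e′ p′ n = begin
    ∑ (suc e′) (λ i → p′ i * hankel s (suc e) p (n ℕ.+ i))
      ≡⟨ ∑-cong (suc e′) (λ i _ → *-distribˡ-∑ (suc e) (p′ i) (λ j → p j * s ((n ℕ.+ i) ℕ.+ j))) ⟩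
    ∑ (suc e′) (λ i → ∑ (suc e) (λ j → p′ i * (p j * s ((n ℕ.+ i) ℕ.+ j))))
      ≡⟨ ∑-comm (suc e′) (suc e) (λ i j → p′ i * (p j * s ((n ℕ.+ i) ℕ.+ j))) ⟩
    ∑ (suc e) (λ j → ∑ (suc e′) (λ i → p′ i * (p j * s ((n ℕ.+ i) ℕ.+ j))))
      ≡⟨ ∑-cong (suc e) (λ j _ → ∑-cong (suc e′) (λ i _ → swap i j)) ⟩
    ∑ (suc e) (λ j → ∑ (suc e′) (λ i → p j * (p′ i * s ((n ℕ.+ j) ℕ.+ i))))
      ≡⟨ ∑-cong (suc e) (λ j _ → *-distribˡ-∑ (suc e′) (p j) (λ i → p′ i * s ((n ℕ.+ j) ℕ.+ i))) ⟨
    ∑ (suc e) (λ j → p j * hankel s (suc e′) p′ (n ℕ.+ j))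
      ∎
    where
    open ≡-Reasoning
    swap : ∀ i j → p′ i * (p j * s ((n ℕ.+ i) ℕ.+ j)) ≡ p j * (p′ i * s ((n ℕ.+ j) ℕ.+ i))
    swap i j = trans (x*yz≡y*xz (p′ i) (p j) _) (cong (λ t → p j * (p′ i * s t)) (+-right-comm n i j))

  cross-firstNonzero : ∀ e p e′ p′ {m} → p′ e′ ≢ 0# → FirstNonzero (hankel s (suc e) p) m → e′ < m →
                       FirstNonzero (cross e p e′ p′) (m ∸ e′)
  cross-firstNonzero e p e′ p′ {m} lead≢0 (_ , below , Pm≢0) e′<m =
    ℕₚ.m<n⇒0<n∸m e′<m , below′ , at-m∸e′
    where
    m∸e′+e′≡m : (m ∸ e′) ℕ.+ e′ ≡ m
    m∸e′+e′≡m = ℕₚ.m∸n+n≡m (ℕₚ.<⇒≤ e′<m)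
    cross-top : ∀ {n} → 1 ≤ n → n ℕ.+ e′ ≤ m → cross e p e′ p′ n ≡ p′ e′ * hankel s (suc e) p (n ℕ.+ e′)
    cross-top {n} 1≤n n+e′≤m = ∑-single (suc e′) _ e′ ℕₚ.≤-refl λ i i<1+e′ i≢e′ →
      trans (cong (p′ i *_) (below (n ℕ.+ i) (ℕₚ.≤-trans 1≤n (ℕₚ.m≤m+n n i))
                              (ℕₚ.<-≤-trans (ℕₚ.+-monoʳ-< n (ℕₚ.≤∧≢⇒< (ℕₚ.≤-pred i<1+e′) i≢e′)) n+e′≤m)))
            (zeroʳ _)
    below′ : ∀ n → 1 ≤ n → n < m ∸ e′ → cross e p e′ p′ n ≡ 0#
    below′ n 1≤n n<m∸e′ =
      let n+e′<m = subst (n ℕ.+ e′ <_) m∸e′+e′≡m (ℕₚ.+-monoˡ-< e′ n<m∸e′)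
      in trans (cross-top 1≤n (ℕₚ.<⇒≤ n+e′<m))
               (trans (cong (p′ e′ *_) (below _ (ℕₚ.≤-trans 1≤n (ℕₚ.m≤m+n n e′)) n+e′<m)) (zeroʳ _))
    at-m∸e′ : cross e p e′ p′ (m ∸ e′) ≢ 0#
    at-m∸e′ = *-nonzero lead≢0 (Pm≢0 ∘ subst (λ t → hankel s (suc e) p t ≡ 0#) m∸e′+e′≡m)
            ∘ trans (sym (cross-top (ℕₚ.m<n⇒0<n∸m e′<m) (ℕₚ.≤-reflexive m∸e′+e′≡m)))

  firstNonzero-balance : ∀ e p e′ p′ {m m′} → p e ≢ 0# → p′ e′ ≢ 0# →
    FirstNonzero (hankel s (suc e) p) m → FirstNonzero (hankel s (suc e′) p′) m′ →
    e′ < m → e < m′ → m ℕ.+ e ≡ m′ ℕ.+ e′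
  firstNonzero-balance e p e′ p′ {m} {m′} lead≢0 lead′≢0 first first′ e′<m e<m′ = begin
    m ℕ.+ e                     ≡⟨ cong (ℕ._+ e) (ℕₚ.m∸n+n≡m (ℕₚ.<⇒≤ e′<m)) ⟨
    ((m ∸ e′) ℕ.+ e′) ℕ.+ e     ≡⟨ cong (λ t → (t ℕ.+ e′) ℕ.+ e) m∸e′≡m′∸e ⟩
    ((m′ ∸ e) ℕ.+ e′) ℕ.+ e     ≡⟨ +-right-comm (m′ ∸ e) e′ e ⟩
    ((m′ ∸ e) ℕ.+ e) ℕ.+ e′     ≡⟨ cong (ℕ._+ e′) (ℕₚ.m∸n+n≡m (ℕₚ.<⇒≤ e<m′)) ⟩
    m′ ℕ.+ e′                   ∎
    where
    open ≡-Reasoning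
    m∸e′≡m′∸e : m ∸ e′ ≡ m′ ∸ e
    m∸e′≡m′∸e = firstNonzero-unique (cross-firstNonzero e p e′ p′ lead′≢0 first e′<m)
      (firstNonzero-cong (λ n → cross-sym e′ p′ e p n) (cross-firstNonzero e′ p′ e p lead≢0 first′ e<m′))

module HankelRegularity (F : FiniteField) (em : ExcludedMiddle 0ℓ)
                        (ξ : LaurentSeries.Laurent F) (ξ-irrational : ¬ LaurentSeries.IsRational F ξ) where
  open Field F
  open LaurentSeries F
  open Sequences F

  ξ⁻ : ℕ → Carrier
  ξ⁻ = coeff ξ ∘ neg

  open HankelCross F ξ⁻

  Qξ : NZPoly → ℕ → Carrier
  Qξ Q = hankel ξ⁻ (suc (deg Q)) (coeffAt (cf Q))

  -- Q lies in the kernel of the (d + 1) × (d + 1) Hankel matrix (ξ⁻ (i + j)), 1 ≤ i ≤ d + 1, 0 ≤ j ≤ d.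
  InKernel : ℕ → NZPoly → Set
  InKernel d Q = deg Q ≤ d × (∀ k → 1 ≤ k → k ≤ suc d → Qξ Q k ≡ 0#)

  Regular : ℕ → Set
  Regular d = ∀ Q → ¬ InKernel d Q

  Qξ-firstNonzero : ∀ Q → ∃ (FirstNonzero (Qξ Q))
  Qξ-firstNonzero Q =
    let m , first = nonpolynomial⇒firstNonzero em _ (λ Qξ-poly → ξ-irrational (Q , Qξ-poly))
    in m , firstNonzero-cong (mulC-neg (cf Q) (coeff ξ)) first

  kernel-firstNonzero : ∀ {d m} Q → InKernel d Q → FirstNonzero (Qξ Q) m → suc d < m
  kernel-firstNonzero Q (_ , vanish) (1≤m , _ , Qξm≢0) =
    ℕₚ.≰⇒> λ m≤1+d → Qξm≢0 (vanish _ 1≤m m≤1+d)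

  -- With ‖Q′ξ‖ = q^{-m′}, firstNonzero-balance gives (d + 1) + deg Q = m′ + deg Q′, and m′ > d + 1.
  kernel-degree-drops : ∀ {d₀ d} Q Q′ → InKernel d₀ Q → FirstNonzero (Qξ Q) (suc d) → InKernel d Q′ →
                        deg Q′ < deg Q
  kernel-degree-drops {d₀} {d} Q Q′ ker first ker′ =
    let m′ , first′ = Qξ-firstNonzero Q′
        1+d<m′ = kernel-firstNonzero Q′ ker′ first′
        Q<m′ = ℕₚ.≤-<-trans (proj₁ ker)
                 (ℕₚ.<-trans (ℕₚ.≤-pred (kernel-firstNonzero Q ker first)) (ℕₚ.<-trans (ℕₚ.n<1+n d) 1+d<m′))
        balance = firstNonzero-balance (deg Q) (coeffAt (cf Q)) (deg Q′) (coeffAt (cf Q′))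
                    (coeffAt-lead Q) (coeffAt-lead Q′) first first′ (s≤s (proj₁ ker′)) Q<m′
    in ℕₚ.+-cancelˡ-< (suc d) (deg Q′) (deg Q) (begin-strict
         suc d ℕ.+ deg Q′   <⟨ ℕₚ.+-monoˡ-< (deg Q′) 1+d<m′ ⟩
         m′ ℕ.+ deg Q′      ≡⟨ balance ⟨
         suc d ℕ.+ deg Q    ∎)
    where open ℕₚ.≤-Reasoning

  regular-kernel-trivial : ∀ d → Regular d → ∀ u → (∀ k → k < suc d → hankel ξ⁻ (suc d) u (suc k) ≡ 0#) →
                           ∀ j → j < suc d → u j ≡ 0#
  regular-kernel-trivial d regular u Hu≡0 with lastNonzero-or-vanish (suc d) u
  ... | inj₂ u≡0 = u≡0
  ... | inj₁ (e , e<1+d , ue≢0 , above) = contradiction (ℕₚ.≤-pred e<1+d , kernel) (regular (toNZPoly u e ue≢0))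
    where
    kernel : ∀ k → 1 ≤ k → k ≤ suc d → Qξ (toNZPoly u e ue≢0) k ≡ 0#
    kernel (suc k) _ k<1+d = trans (hankel-toNZPoly ξ⁻ u e ue≢0 e<1+d above (suc k)) (Hu≡0 k k<1+d)

  regular-above-kernel : ∀ b d₀ Q → deg Q < b → InKernel d₀ Q → ∃ λ d → d₀ ≤ d × Regular d
  regular-above-kernel (suc b) d₀ Q (s≤s Q≤b) ker with Qξ-firstNonzero Q
  ... | zero  , () , _
  ... | suc d , first with em {∃ (InKernel d)}
  ...   | no  none = d , ℕₚ.<⇒≤ (ℕₚ.≤-pred (kernel-firstNonzero Q ker first)) , λ Q′ ker′ → none (Q′ , ker′)
  ...   | yes (Q′ , ker′) = regular-above-kernel b d₀ Q′ (ℕₚ.<-≤-trans Q′<Q Q≤b) ker₀′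
    where
    d₀<d = ℕₚ.≤-pred (kernel-firstNonzero Q ker first)
    Q′<Q = kernel-degree-drops Q Q′ ker first ker′
    ker₀′ : InKernel d₀ Q′
    ker₀′ = ℕₚ.<⇒≤ (ℕₚ.<-≤-trans Q′<Q (proj₁ ker)) ,
            λ k 1≤k k≤1+d₀ → proj₂ ker′ k 1≤k (ℕₚ.≤-trans k≤1+d₀ (s≤s (ℕₚ.<⇒≤ d₀<d)))

  regular-unbounded : ∀ d₀ → ∃ λ d → d₀ ≤ d × Regular d
  regular-unbounded d₀ with em {∃ (InKernel d₀)}
  ... | no  none = d₀ , ℕₚ.≤-refl , λ Q ker → none (Q , ker)
  ... | yes (Q , ker) = regular-above-kernel (suc (deg Q)) d₀ Q ℕₚ.≤-refl ker

module Inhomogeneous (F : FiniteField) (em : ExcludedMiddle 0ℓ)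
                     (ξ α : LaurentSeries.Laurent F) (ξ-irrational : ¬ LaurentSeries.IsRational F ξ)
                     (α∉lattice : ¬ LaurentSeries.InLattice F ξ α) where
  open Field F
  open LaurentSeries F
  open Sequences F
  open HankelRegularity F em ξ ξ-irrational
  open ≡-Reasoning

  α⁻ : ℕ → Carrier
  α⁻ = coeff α ∘ neg

  Qξ-α : NZPoly → ℤ → Carrier
  Qξ-α Q = subC (mulC (coeffs Q) (coeff ξ)) (coeff α)

  Qξ-α-nonzero : ∀ P → ∃ λ k → 1 ≤ k × Qξ-α P (neg k) ≢ 0#
  Qξ-α-nonzero P =
    let k , 1≤k , _ , α-Pξ≢0 = nonpolynomial⇒firstNonzero em _ (λ poly → α∉lattice (coeffs P , poly))
    in k , 1≤k , x-y≢0⇒y-x≢0 α-Pξ≢0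

  α-nonzero : ∃ λ k → 1 ≤ k × α⁻ k ≢ 0#
  α-nonzero =
    let k , 1≤k , _ , αk≢0 = nonpolynomial⇒firstNonzero em (coeff α) λ α-poly →
          α∉lattice ([] , λ i i<0 → trans (cong (coeff α i +_) -0#≈0#) (trans (+-identityʳ _) (α-poly i i<0)))
    in k , 1≤k , αk≢0

  hankel-onto : ∀ d → Regular d → ∀ t → ∃ λ u → (λ i → hankel ξ⁻ (suc d) u (suc i)) ≡[< suc d ] t
  hankel-onto d regular = prefixInjective⇒onto (suc d) H H-cong H-injective
    where
    open PrefixCode enum 0#

    H : (ℕ → Carrier) → ℕ → Carrier
    H u i = hankel ξ⁻ (suc d) u (suc i)

    H-cong : ∀ {f g} → f ≡[< suc d ] g → H f ≡[< suc d ] H g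
    H-cong f≡g i _ = hankel-cong ξ⁻ (suc d) f≡g (suc i)

    H-injective : ∀ {f g} → H f ≡[< suc d ] H g → f ≡[< suc d ] g
    H-injective {f} {g} Hf≡Hg j j<1+d =
      x∙y⁻¹≈ε⇒x≈y _ _ (regular-kernel-trivial d regular (λ j → f j + - g j) H[f-g]≡0 j j<1+d)
      where
      H[f-g]≡0 : ∀ k → k < suc d → hankel ξ⁻ (suc d) (λ j → f j + - g j) (suc k) ≡ 0#
      H[f-g]≡0 k k<1+d = trans (hankel-sub ξ⁻ (suc d) f g (suc k)) (x≈y⇒x∙y⁻¹≈ε (Hf≡Hg k k<1+d))

  approximant : ∀ d → Regular d → ∀ {kα} → 1 ≤ kα → kα ≤ suc d → α⁻ kα ≢ 0# →
    ∃ λ Q → deg Q ≤ d × (∀ k → 1 ≤ k → k ≤ suc d → Qξ-α Q (neg k) ≡ 0#)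
  approximant d regular {kα} 1≤kα kα≤1+d αkα≢0 with hankel-onto d regular (α⁻ ∘ suc)
  ... | u , Hu≡α with lastNonzero-or-vanish (suc d) u
  ...   | inj₂ u≡0 = contradiction (α-vanishes kα 1≤kα kα≤1+d) αkα≢0
    where
    α-vanishes : ∀ k → 1 ≤ k → k ≤ suc d → α⁻ k ≡ 0#
    α-vanishes (suc k) _ k<1+d = trans (sym (Hu≡α k k<1+d))
      (∑-zero (suc d) λ j j<1+d → trans (cong (_* ξ⁻ (suc k ℕ.+ j)) (u≡0 j j<1+d)) (zeroˡ _))
  ...   | inj₁ (e , e<1+d , ue≢0 , above) = toNZPoly u e ue≢0 , ℕₚ.≤-pred e<1+d , vanish
    where
    Q = toNZPoly u e ue≢0
    vanish : ∀ k → 1 ≤ k → k ≤ suc d → Qξ-α Q (neg k) ≡ 0#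
    vanish (suc k) _ k<1+d = x≈y⇒x∙y⁻¹≈ε (begin
      mulC (coeffs Q) (coeff ξ) (neg (suc k)) ≡⟨ mulC-neg (cf Q) (coeff ξ) (suc k) ⟩
      Qξ Q (suc k)                            ≡⟨ hankel-toNZPoly ξ⁻ u e ue≢0 e<1+d above (suc k) ⟩
      hankel ξ⁻ (suc d) u (suc k)             ≡⟨ Hu≡α k k<1+d ⟩
      α⁻ (suc k)                              ∎)

  Witnessed : ℕ → NZPoly → Set
  Witnessed D P = ∃ λ k → 1 ≤ k × k ≤ D × Qξ-α P (neg k) ≢ 0#

  witness-bound : ∀ L → ∃ λ D → All (Witnessed D) L
  witness-bound []      = 0 , []
  witness-bound (P ∷ L) =
    let D , witnessed = witness-bound L
        k , 1≤k , Pk≢0 = Qξ-α-nonzero P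
    in k ℕ.+ D , (k , 1≤k , ℕₚ.m≤m+n k D , Pk≢0)
               ∷ All.map (λ (k′ , 1≤k′ , k′≤D , P′k′≢0) → k′ , 1≤k′ , ℕₚ.m≤n⇒m≤o+n k k′≤D , P′k′≢0) witnessed

  approximant-avoiding : ∀ L → ∃ λ Q → All (λ P → coeffs P ≢ coeffs Q) L × NormLE (Qξ-α Q) (deg Q ℕ.+ 2)
  approximant-avoiding L =
    let D , witnessed = witness-bound L
        kα , 1≤kα , αkα≢0 = α-nonzero
        d , D+kα≤d , regular = regular-unbounded (D ℕ.+ kα)
        Q , Q≤d , vanish = approximant d regular 1≤kα
                             (ℕₚ.m≤n⇒m≤1+n (ℕₚ.≤-trans (ℕₚ.m≤n+m kα D) D+kα≤d)) αkα≢0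
        distinct : ∀ {P} → Witnessed D P → coeffs P ≢ coeffs Q
        distinct = λ (k , 1≤k , k≤D , Pk≢0) P≡Q → Pk≢0 (trans
          (cong (λ cs → subC (mulC cs (coeff ξ)) (coeff α) (neg k)) P≡Q)
          (vanish k 1≤k (ℕₚ.m≤n⇒m≤1+n (ℕₚ.≤-trans k≤D (ℕₚ.≤-trans (ℕₚ.m≤m+n D kα) D+kα≤d)))))
    in Q , All.map (λ {P} → distinct {P}) witnessed , λ i 1≤i i<Q+2 →
         vanish i 1≤i (ℕₚ.≤-trans (ℕₚ.<⇒≤pred (subst (i <_) (ℕₚ.+-comm (deg Q) 2) i<Q+2)) (s≤s Q≤d))

module Extremal (F : FiniteField) where
  open Field F
  open LaurentSeries F
  open Sequences F
  open ≡-Reasoning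

  -- f = ∑ c k T^{-k} is the solution of f = T^{-1} (f² − 1): c 0 = 0, c 1 = −1 and
  -- c (n + 1) = ∑_{a ≤ n} c a c (n − a) for n ≥ 1.  table n i = c i for i ≤ n makes the recursion structural.
  next : ℕ → (ℕ → Carrier) → Carrier
  next zero    c = - 1#
  next (suc m) c = ∑ (suc (suc m)) (λ a → c a * c (suc m ∸ a))

  table : ℕ → ℕ → Carrier
  table zero    i = 0#
  table (suc n) i with i ℕ.≟ suc n
  ... | yes _ = next n (table n)
  ... | no  _ = table n i

  c : ℕ → Carrier
  c i = table i i

  table-top : ∀ n → table (suc n) (suc n) ≡ next n (table n)
  table-top n with suc n ℕ.≟ suc n
  ... | yes _  = refl
  ... | no  ≢n = contradiction refl ≢n

  table-stable : ∀ {n i} → i ≤ n → table n i ≡ c i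
  table-stable {zero}  z≤n  = refl
  table-stable {suc n} {i} i≤1+n with i ℕ.≟ suc n
  ... | yes refl = sym (table-top n)
  ... | no  i≢1+n = table-stable (ℕₚ.≤-pred (ℕₚ.≤∧≢⇒< i≤1+n i≢1+n))

  c-1 : c 1 ≡ - 1#
  c-1 = table-top 0

  c-convolution : ∀ n → 1 ≤ n → ∑ (suc n) (λ a → c a * c (n ∸ a)) ≡ c (suc n)
  c-convolution (suc m) _ = sym (trans (table-top (suc m)) (∑-cong (suc (suc m)) λ a a<2+m →
    cong₂ _*_ (table-stable (ℕₚ.≤-pred a<2+m)) (table-stable (ℕₚ.m∸n≤m (suc m) a))))

  Annihilated : ℕ → (ℕ → Carrier) → Set
  Annihilated D r = ∀ k → 1 ≤ k → k ≤ suc D → hankel c (suc D) r k ≡ 0#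

  head : ℕ → ℕ → Carrier
  head j k = ∑ k (λ a → c a * c ((k ℕ.+ j) ∸ a))

  -- Since c 0 = 0, the terms with m ≥ j vanish, so the range n is immaterial once j ≤ n.
  convolution-split : ∀ n j k → j ≤ n → 1 ≤ k →
    head j k + ∑ n (λ m → c (j ∸ m) * c (k ℕ.+ m)) ≡ c (suc (k ℕ.+ j))
  convolution-split n j k j≤n 1≤k = begin
    head j k + ∑ n t
      ≡⟨ cong (head j k +_) (trans (∑-truncate t j≤n t≥j) (sym (∑-truncate t (ℕₚ.n≤1+n j) t≥j))) ⟩
    head j k + ∑ (suc j) t
      ≡⟨ cong (head j k +_) (∑-cong (suc j) λ m _ → reindex m) ⟩
    ∑ k g + ∑ (suc j) (λ m → g (k ℕ.+ m))
      ≡⟨ ∑-split k (suc j) g ⟨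
    ∑ (k ℕ.+ suc j) g
      ≡⟨ cong (λ l → ∑ l g) (ℕₚ.+-suc k j) ⟩
    ∑ (suc (k ℕ.+ j)) g
      ≡⟨ c-convolution (k ℕ.+ j) (ℕₚ.≤-trans 1≤k (ℕₚ.m≤m+n k j)) ⟩
    c (suc (k ℕ.+ j))
      ∎
    where
    t g : ℕ → Carrier
    t m = c (j ∸ m) * c (k ℕ.+ m)
    g a = c a * c ((k ℕ.+ j) ∸ a)
    t≥j : ∀ {l} m → j ≤ m → m < l → t m ≡ 0#
    t≥j m j≤m _ = trans (cong (λ i → c i * c (k ℕ.+ m)) (ℕₚ.m≤n⇒m∸n≡0 j≤m)) (zeroˡ _)
    reindex : ∀ m → t m ≡ g (k ℕ.+ m)
    reindex m = trans (*-comm _ _) (cong (λ i → c (k ℕ.+ m) * c i) (sym (ℕₚ.[m+n]∸[m+o]≡n∸o k j m)))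

  -- Coefficients of the polynomial part of r f, the terms j ≤ m vanishing as c 0 = 0.
  polyPart : ℕ → (ℕ → Carrier) → ℕ → Carrier
  polyPart n r m = ∑ n (λ j → r j * c (j ∸ m))

  head-annihilated : ∀ D r → Annihilated (suc D) r → ∀ k → k ≤ suc D →
                     ∑ (suc (suc D)) (λ j → r j * head j k) ≡ 0#
  head-annihilated D r annihilated k k≤1+D = begin
    ∑ n (λ j → r j * head j k)
      ≡⟨ ∑-cong n (λ j _ → *-distribˡ-∑ k (r j) (λ a → c a * c ((k ℕ.+ j) ∸ a))) ⟩
    ∑ n (λ j → ∑ k (λ a → r j * (c a * c ((k ℕ.+ j) ∸ a))))
      ≡⟨ ∑-comm n k (λ j a → r j * (c a * c ((k ℕ.+ j) ∸ a))) ⟩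
    ∑ k (λ a → ∑ n (λ j → r j * (c a * c ((k ℕ.+ j) ∸ a))))
      ≡⟨ ∑-cong k (λ a _ → trans (∑-cong n λ j _ → x*yz≡y*xz (r j) (c a) (c ((k ℕ.+ j) ∸ a)))
                                  (sym (*-distribˡ-∑ n (c a) (λ j → r j * c ((k ℕ.+ j) ∸ a))))) ⟩
    ∑ k (λ a → c a * ∑ n (λ j → r j * c ((k ℕ.+ j) ∸ a)))
      ≡⟨ ∑-zero k term≡0 ⟩
    0#
      ∎
    where
    n = suc (suc D)
    term≡0 : ∀ a → a < k → c a * ∑ n (λ j → r j * c ((k ℕ.+ j) ∸ a)) ≡ 0#
    term≡0 zero    _   = zeroˡ _
    term≡0 (suc a) a<k = trans (cong (c (suc a) *_) (begin
      ∑ n (λ j → r j * c ((k ℕ.+ j) ∸ suc a))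
        ≡⟨ ∑-cong n (λ j _ → cong (λ i → r j * c i) (ℕₚ.+-∸-comm j (ℕₚ.<⇒≤ a<k))) ⟩
      hankel c n r (k ∸ suc a)
        ≡⟨ annihilated (k ∸ suc a) (ℕₚ.m<n⇒0<n∸m a<k)
                       (ℕₚ.≤-trans (ℕₚ.m∸n≤m k (suc a)) (ℕₚ.m≤n⇒m≤1+n k≤1+D)) ⟩
      0#
        ∎)) (zeroʳ _)

  -- With p = [r f] and ε = r f − p, the identity f² = T f + 1 gives p f ≡ T ε − ε f modulo 𝔽_q[T],
  -- whose first fractional coefficients vanish when those of ε do.
  descent : ∀ D r → Annihilated (suc D) r → Annihilated D (polyPart (suc (suc D)) r)
  descent D r annihilated k 1≤k k≤1+D = begin
    hankel c (suc D) (polyPart n r) k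
      ≡⟨ ∑-cong (suc D) (λ m _ → trans (*-distribʳ-∑ n (c (k ℕ.+ m)) (λ j → r j * c (j ∸ m)))
                                          (∑-cong n λ j _ → *-assoc (r j) (c (j ∸ m)) (c (k ℕ.+ m)))) ⟩
    ∑ (suc D) (λ m → ∑ n (λ j → r j * (c (j ∸ m) * c (k ℕ.+ m))))
      ≡⟨ ∑-comm (suc D) n (λ m j → r j * (c (j ∸ m) * c (k ℕ.+ m))) ⟩
    ∑ n (λ j → ∑ (suc D) (λ m → r j * (c (j ∸ m) * c (k ℕ.+ m))))
      ≡⟨ ∑-cong n (λ j _ → sym (*-distribˡ-∑ (suc D) (r j) (λ m → c (j ∸ m) * c (k ℕ.+ m)))) ⟩
    ∑ n (λ j → r j * tail j)
      ≡⟨ +-identityˡ _ ⟨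
    0# + ∑ n (λ j → r j * tail j)
      ≡⟨ cong (_+ ∑ n (λ j → r j * tail j)) (head-annihilated D r annihilated k k≤1+D) ⟨
    ∑ n (λ j → r j * head j k) + ∑ n (λ j → r j * tail j)
      ≡⟨ ∑-distrib-+ n (λ j → r j * head j k) (λ j → r j * tail j) ⟨
    ∑ n (λ j → r j * head j k + r j * tail j)
      ≡⟨ ∑-cong n (λ j j<n → trans (sym (distribˡ (r j) _ _))
                                    (cong (r j *_) (convolution-split (suc D) j k (ℕₚ.≤-pred j<n) 1≤k))) ⟩
    hankel c n r (suc k)
      ≡⟨ annihilated (suc k) (s≤s z≤n) (s≤s k≤1+D) ⟩
    0#
      ∎
    where
    n = suc (suc D)
    tail : ℕ → Carrier
    tail j = ∑ (suc D) (λ m → c (j ∸ m) * c (k ℕ.+ m))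

  kernel-trivial : ∀ D r → r D ≢ 0# → ¬ Annihilated D r
  kernel-trivial zero r r0≢0 annihilated = *-nonzero r0≢0 -1#≢0# (begin
    r 0 * - 1#       ≡⟨ cong (r 0 *_) c-1 ⟨
    r 0 * c 1        ≡⟨ +-identityʳ _ ⟨
    hankel c 1 r 1   ≡⟨ annihilated 1 ℕₚ.≤-refl (s≤s z≤n) ⟩
    0#               ∎)
  kernel-trivial (suc D) r r≢0 annihilated =
    kernel-trivial D (polyPart (suc (suc D)) r) top≢0 (descent D r annihilated)
    where
    top≢0 : polyPart (suc (suc D)) r D ≢ 0#
    top≢0 pD≡0 = *-nonzero r≢0 -1#≢0# (begin
      r (suc D) * - 1#               ≡⟨ cong (r (suc D) *_) (trans (cong c (ℕₚ.m+n∸n≡m 1 D)) c-1) ⟨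
      r (suc D) * c (suc D ∸ D)      ≡⟨ ∑-single (suc (suc D)) _ (suc D) ℕₚ.≤-refl below ⟨
      polyPart (suc (suc D)) r D     ≡⟨ pD≡0 ⟩
      0#                             ∎)
      where
      below : ∀ j → j < suc (suc D) → j ≢ suc D → r j * c (j ∸ D) ≡ 0#
      below j j<2+D j≢1+D =
        let j≤D = ℕₚ.≤-pred (ℕₚ.≤∧≢⇒< (ℕₚ.≤-pred j<2+D) j≢1+D)
        in trans (cong (λ i → r j * c i) (ℕₚ.m≤n⇒m∸n≡0 j≤D)) (zeroʳ _)

  ξ₀C : ℤ → Carrier
  ξ₀C (pos _)    = 0#
  ξ₀C -[1+ n ] = c (suc (suc n))

  ξ₀ : Laurent
  ξ₀ = mkLaurent ξ₀C (0 , λ { (pos _) _ → refl })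

  TinvOneMinus-ξ₀ : ∀ k → - TinvOneMinus ξ₀ (neg (suc k)) ≡ c (suc k)
  TinvOneMinus-ξ₀ zero = begin
    - (1# + - 0#)   ≡⟨ cong (λ x → - (1# + x)) -0#≈0# ⟩
    - (1# + 0#)     ≡⟨ cong -_ (+-identityʳ 1#) ⟩
    - 1#            ≡⟨ c-1 ⟨
    c 1             ∎
  TinvOneMinus-ξ₀ (suc k) = begin
    - (0# + - c (suc (suc k)))  ≡⟨ cong -_ (+-identityˡ _) ⟩
    - - c (suc (suc k))         ≡⟨ -‿involutive _ ⟩
    c (suc (suc k))             ∎

  constPlusT : Carrier → NZPoly → ℕ → Carrier
  constPlusT b Q zero    = b
  constPlusT b Q (suc j) = coeffAt (cf Q) j

  -- Since ξ₀ = 1 + T f, (b + T Q) f = b f + Q ξ₀ − Q.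
  hankel-constPlusT : ∀ b Q k →
    hankel c (suc (suc (deg Q))) (constPlusT b Q) (suc k) ≡ b * c (suc k) + mulC (coeffs Q) ξ₀C (neg (suc k))
  hankel-constPlusT b Q k = cong₂ _+_
    (cong (λ i → b * c (suc i)) (ℕₚ.+-identityʳ k))
    (trans (∑-cong (suc (deg Q)) λ j _ → cong (λ i → coeffAt (cf Q) j * c (suc i)) (ℕₚ.+-suc k j))
           (sym (mulC-neg (cf Q) ξ₀C (suc k))))

  ξ₀-irrational : ¬ IsRational ξ₀
  ξ₀-irrational (Q , Qξ₀-poly) = kernel-trivial (suc (deg Q)) (constPlusT 0# Q) (coeffAt-lead Q) annihilated
    where
    annihilated : Annihilated (suc (deg Q)) (constPlusT 0# Q)
    annihilated (suc k) _ _ = begin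
      hankel c (suc (suc (deg Q))) (constPlusT 0# Q) (suc k)
        ≡⟨ hankel-constPlusT 0# Q k ⟩
      0# * c (suc k) + mulC (coeffs Q) ξ₀C (neg (suc k))
        ≡⟨ cong₂ _+_ (zeroˡ _) (Qξ₀-poly (neg (suc k)) ℤ.-<+) ⟩
      0# + 0#
        ≡⟨ +-identityˡ 0# ⟩
      0#
        ∎

  ξ₀-far : ∀ Q → NormGE (subC (mulC (coeffs Q) ξ₀C) (TinvOneMinus ξ₀)) (deg Q ℕ.+ 2)
  ξ₀-far Q with firstNonzero-or-vanish (deg Q ℕ.+ 2) (subC (mulC (coeffs Q) ξ₀C) (TinvOneMinus ξ₀) ∘ neg)
  ... | inj₁ (m , m≤Q+2 , 1≤m , _ , m≢0) = m , 1≤m , m≤Q+2 , m≢0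
  ... | inj₂ vanish = ⊥-elim (kernel-trivial (suc (deg Q)) (constPlusT 1# Q) (coeffAt-lead Q) annihilated)
    where
    annihilated : Annihilated (suc (deg Q)) (constPlusT 1# Q)
    annihilated (suc k) _ k<2+Q = begin
      hankel c (suc (suc (deg Q))) (constPlusT 1# Q) (suc k)
        ≡⟨ hankel-constPlusT 1# Q k ⟩
      1# * c (suc k) + mulC (coeffs Q) ξ₀C (neg (suc k))
        ≡⟨ +-comm _ _ ⟩
      mulC (coeffs Q) ξ₀C (neg (suc k)) + 1# * c (suc k)
        ≡⟨ cong (mulC (coeffs Q) ξ₀C (neg (suc k)) +_) (trans (*-identityˡ _) (sym (TinvOneMinus-ξ₀ k))) ⟩
      mulC (coeffs Q) ξ₀C (neg (suc k)) + - TinvOneMinus ξ₀ (neg (suc k))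
        ≡⟨ vanish (suc k) (s≤s z≤n) (subst (suc k ≤_) (ℕₚ.+-comm 2 (deg Q)) k<2+Q) ⟩
      0#
        ∎

open import Data.Nat using (_+_)

theorem1p1 : (F : FiniteField) → let open LaurentSeries F in
    (ExcludedMiddle 0ℓ →
      ∀ (ξ α : Laurent) → ¬ IsRational ξ → ¬ InLattice ξ α →
      ∀ (L : List NZPoly) → ∃ λ (Q : NZPoly) →
        All (λ P → coeffs P ≢ coeffs Q) L ×
        NormLE (subC (mulC (coeffs Q) (coeff ξ)) (coeff α)) (deg Q + 2))
    ×
    (∃ λ (ξ : Laurent) → InTinvPowerSeries ξ × ¬ IsRational ξ ×
      ∀ (Q : NZPoly) →
        NormGE (subC (mulC (coeffs Q) (coeff ξ)) (TinvOneMinus ξ)) (deg Q + 2))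
theorem1p1 F =
  (λ em ξ α ξ-irrational α∉lattice → Inhomogeneous.approximant-avoiding F em ξ α ξ-irrational α∉lattice) ,
  (ξ₀ , (λ _ → refl) , ξ₀-irrational , ξ₀-far)
  where open Extremal F
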